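{- Let $\ell_{in},\ell_{out},\ell$ be positive integers with $\ell\ge \ell_{in}$, $\ell\ge\ell_{out}$ and $\ell_{out}<\ell$, let $m=2^{\ell_{out}}$, and let $n\le 2^{\ell_{in}}$ satisfy $n<m$ and $m = O(n)$. For an $\ell$-bit multiplier $a$ define $h_a(x) = \lfloor (ax \bmod 2^\ell)/2^{\ell-\ell_{out}}\rfloor \in [m]$. If $a$ is a uniformly distributed odd $\ell$-bit number and $h_a$ is used to insert the keys $[n]=\{0,\dots,n-1\}$ into a linear probing table of size $m$, then the expected average insertion cost per key is $\Omega(\log n)$.
   Context: Linear probing: the table is an array of $m$ cells indexed cyclically by $[m]$; to insert $x$, the cells $h(x),h(x)+1,\dots$ (mod $m$) are scanned and $x$ is placed in the first empty cell; the insertion cost is the number of cells scanned. The average insertion cost is the total insertion cost divided by the number of keys. -}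

module Defs where

open import Data.Nat using (ℕ; zero; suc; _+_; _*_; _∸_; _^_; _≡ᵇ_)
open import Data.Nat.DivMod using (_/_; _%_)
open import Data.Nat.Properties using (m^n≢0)
open import Data.Bool using (Bool; true; false; if_then_else_)
open import Data.List using (List; []; _∷_; upTo; map)
open import Data.Bool.ListAction using (any)
open import Data.Nat.ListAction using (sum)
open import Data.Product using (_×_; _,_; proj₁; proj₂)

pow2 : ℕ → ℕ
pow2 k = 2 ^ k

hash : (ℓ ℓout a x : ℕ) → ℕ
hash ℓ ℓout a x =
  _/_ (_%_ (a * x) (pow2 ℓ) {{m^n≢0 2 ℓ}}) (pow2 (ℓ ∸ ℓout)) {{m^n≢0 2 (ℓ ∸ ℓout)}}

-- is cell p occupied? (the table is the list of occupied cells)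
occupied : List ℕ → ℕ → Bool
occupied occ p = any (λ q → q ≡ᵇ p) occ

-- Linear probing in a table of size 2^ℓout starting at cell pos, with fuel.
-- Returns (number of cells scanned, cell where the key is placed).
probe : (ℓout : ℕ) → List ℕ → (fuel pos : ℕ) → ℕ × ℕ
probe ℓout occ zero pos = 0 , pos
probe ℓout occ (suc f) pos =
  if occupied occ pos
  then (let r = probe ℓout occ f (_%_ (suc pos) (pow2 ℓout) {{m^n≢0 2 ℓout}})
        in suc (proj₁ r) , proj₂ r)
  else (1 , pos)

-- Insert the given keys in order into the table (occupied cells occ),
-- using hash function h; returns total insertion cost.
-- Fuel 2^ℓout = m suffices whenever fewer than m keys are inserted.
insertAll : (ℓout : ℕ) → (h : ℕ → ℕ) → List ℕ → List ℕ → ℕ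
insertAll ℓout h occ [] = 0
insertAll ℓout h occ (x ∷ xs) =
  let r = probe ℓout occ (pow2 ℓout) (h x)
  in proj₁ r + insertAll ℓout h (proj₂ r ∷ occ) xs

totalCost : (ℓ ℓout n a : ℕ) → ℕ
totalCost ℓ ℓout n a = insertAll ℓout (hash ℓ ℓout a) [] (upTo n)

-- Sum over all odd ℓ-bit multipliers a = 2j+1, 0 ≤ j < 2^(ℓ-1),
-- of the total insertion cost.  The expected average insertion cost is
-- sumCostOdd / (2^(ℓ-1) * n).
sumCostOdd : (ℓ ℓout n : ℕ) → ℕ
sumCostOdd ℓ ℓout n = sum (map (λ j → totalCost ℓ ℓout n (suc (2 * j))) (upTo (2 ^ (ℓ ∸ 1))))

-- Fix an odd multiplier a, write E x = a x mod 2^ℓ and s = 2^(ℓ - ℓout), so the hash of x is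
-- ⌊E x / s⌋ mod m. If 2 E q ≤ s, the keys r, q + r, 2q + r, … of a residue class climb by at
-- most one cell every two keys, yet linear probing puts them in distinct cells; hence g such
-- keys cost Ω(g²), and the first n keys cost at least n²/(16 q) in total.
-- Call an odd y < n/4 selected if s/16 < E y ≤ s/2. Two selected y < y′ differ by some q with
-- 2 E q ≤ s and lie within a factor 8 of each other, so the weights n²/y of the selected y
-- telescope to at most 128 times the cost for a.
-- Multiplication by a permutes the odd residues, so every odd y is selected for at least
-- s/16 of the 2^(ℓ-1) multipliers. Averaging over the multipliers turns the harmonic sum
-- ∑ n²/y ≈ n² log n into an expected total cost of Ω(n² log n · s / 2^ℓ) = Ω(n log n),
-- since 2^ℓ = m s ≤ C n s.

module Submission where

open import Data.Bool using (Bool; true; false; if_then_else_; T; _∧_; _∨_)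
open import Data.Bool.Properties using (∨-zeroʳ; T-≡; T-∧)
open import Data.Empty using (⊥; ⊥-elim)
open import Data.List using (List; []; _∷_; length; map; applyUpTo)
open import Data.Nat
open import Data.Nat.DivMod
open import Data.Nat.Induction using (<-rec)
open import Data.Nat.ListAction using (sum)
open import Data.Nat.Logarithm using (⌊log₂_⌋; ⌊log₂⌋-mono-≤; ⌊log₂[2^n]⌋≡n; ⌊log₂⌊n/2⌋⌋≡⌊log₂n⌋∸1)
open import Data.Nat.Properties
open import Data.Nat.Tactic.RingSolver using (solve-∀)
open import Data.Product using (Σ; _×_; _,_; proj₁; proj₂)
open import Data.Sum using (_⊎_; inj₁; inj₂)
open import Data.Unit using (tt)
open import Function using (case_of_)
open import Function.Bundles using (Equivalence)
open import Relation.Binary.Definitions using (tri<; tri≈; tri>)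
open import Relation.Binary.PropositionalEquality
open import Relation.Nullary using (yes; no)
open import Defs

∑ : (ℕ → ℕ) → ℕ → ℕ
∑ f zero    = 0
∑ f (suc n) = f 0 + ∑ (λ i → f (suc i)) n

syntax ∑ (λ i → e) n = ∑[ i < n ] e

∑-cong : ∀ n {f g : ℕ → ℕ} → (∀ i → i < n → f i ≡ g i) → ∑ f n ≡ ∑ g n
∑-cong zero    f≡g = refl
∑-cong (suc n) f≡g = cong₂ _+_ (f≡g 0 z<s) (∑-cong n (λ i i<n → f≡g (suc i) (s<s i<n)))

∑-mono-≤ : ∀ n {f g : ℕ → ℕ} → (∀ i → i < n → f i ≤ g i) → ∑ f n ≤ ∑ g n
∑-mono-≤ zero    f≤g = z≤n
∑-mono-≤ (suc n) f≤g = +-mono-≤ (f≤g 0 z<s) (∑-mono-≤ n (λ i i<n → f≤g (suc i) (s<s i<n)))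

∑-distrib-+ : ∀ n (f g : ℕ → ℕ) → ∑[ i < n ] (f i + g i) ≡ ∑ f n + ∑ g n
∑-distrib-+ zero    f g = refl
∑-distrib-+ (suc n) f g
  rewrite ∑-distrib-+ n (λ i → f (suc i)) (λ i → g (suc i)) = interchange (f 0) (g 0) _ _
  where
  interchange : ∀ a b c d → a + b + (c + d) ≡ a + c + (b + d)
  interchange = solve-∀

∑-*ˡ : ∀ n c (f : ℕ → ℕ) → ∑[ i < n ] (c * f i) ≡ c * ∑ f n
∑-*ˡ zero    c f = sym (*-zeroʳ c)
∑-*ˡ (suc n) c f rewrite ∑-*ˡ n c (λ i → f (suc i)) = sym (*-distribˡ-+ c (f 0) _)

∑-const : ∀ n c → ∑[ _ < n ] c ≡ n * c
∑-const zero    c = refl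
∑-const (suc n) c = cong (c +_) (∑-const n c)

∑-count : ∀ n → ∑[ _ < n ] 1 ≡ n
∑-count n = trans (∑-const n 1) (*-identityʳ n)

∑-zero : ∀ n {f : ℕ → ℕ} → (∀ i → i < n → f i ≡ 0) → ∑ f n ≡ 0
∑-zero n f≡0 = trans (∑-cong n f≡0) (trans (∑-const n 0) (*-zeroʳ n))

∑-split : ∀ a b (f : ℕ → ℕ) → ∑ f (a + b) ≡ ∑ f a + ∑[ i < b ] f (a + i)
∑-split zero    b f = refl
∑-split (suc a) b f rewrite ∑-split a b (λ i → f (suc i)) = sym (+-assoc (f 0) _ _)

∑-last : ∀ n (f : ℕ → ℕ) → ∑ f (suc n) ≡ ∑ f n + f n
∑-last n f = begin
  ∑ f (suc n)                  ≡⟨ cong (∑ f) (+-comm 1 n) ⟩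
  ∑ f (n + 1)                  ≡⟨ ∑-split n 1 f ⟩
  ∑ f n + (f (n + 0) + 0)      ≡⟨ cong (∑ f n +_) (trans (+-identityʳ _) (cong f (+-identityʳ n))) ⟩
  ∑ f n + f n                  ∎
  where open ≡-Reasoning

∑-mono-length : ∀ {a b} (f : ℕ → ℕ) → a ≤ b → ∑ f a ≤ ∑ f b
∑-mono-length {a} f a≤b with m≤n⇒∃[o]m+o≡n a≤b
... | o , refl rewrite ∑-split a o f = m≤m+n _ _

∑-swap : ∀ a b (F : ℕ → ℕ → ℕ) → ∑[ i < a ] ∑[ j < b ] F i j ≡ ∑[ j < b ] ∑[ i < a ] F i j
∑-swap zero    b F = sym (∑-zero b (λ _ _ → refl))
∑-swap (suc a) b F rewrite ∑-swap a b (λ i j → F (suc i) j) =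
  sym (∑-distrib-+ b (λ j → F 0 j) (λ j → ∑[ i < a ] F (suc i) j))

∑-blocks : ∀ g q (f : ℕ → ℕ) → ∑ f (g * q) ≡ ∑[ j < g ] ∑[ r < q ] f (j * q + r)
∑-blocks zero    q f = refl
∑-blocks (suc g) q f rewrite ∑-split q (g * q) f | ∑-blocks g q (λ i → f (q + i)) =
  cong (∑ f q +_) (∑-cong g (λ j _ → ∑-cong q (λ r _ → cong f (sym (+-assoc q (j * q) r)))))

∑-gauss : ∀ g → 2 * ∑[ i < g ] i + g ≡ g * g
∑-gauss zero    = refl
∑-gauss (suc g) = begin
  2 * ∑[ i < suc g ] i + suc g  ≡⟨ cong (λ x → 2 * x + suc g) (∑-last g (λ i → i)) ⟩
  2 * (G + g) + suc g           ≡⟨ regroup G g ⟩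
  (2 * G + g) + (2 * g + 1)     ≡⟨ cong (_+ (2 * g + 1)) (∑-gauss g) ⟩
  g * g + (2 * g + 1)           ≡⟨ square g ⟩
  suc g * suc g                 ∎
  where
  open ≡-Reasoning
  G = ∑[ i < g ] i
  regroup : ∀ G g → 2 * (G + g) + suc g ≡ (2 * G + g) + (2 * g + 1)
  regroup = solve-∀
  square : ∀ g → g * g + (2 * g + 1) ≡ suc g * suc g
  square = solve-∀

∑-countdown : ∀ g → ∑[ t < g ] (g ∸ suc t) ≡ ∑[ i < g ] i
∑-countdown zero    = refl
∑-countdown (suc g) = begin
  g + ∑[ t < g ] (g ∸ suc t)  ≡⟨ cong (g +_) (∑-countdown g) ⟩
  g + ∑[ i < g ] i            ≡⟨ +-comm g _ ⟩
  ∑[ i < g ] i + g            ≡⟨ sym (∑-last g (λ i → i)) ⟩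
  ∑[ i < suc g ] i            ∎
  where open ≡-Reasoning

when : Bool → ℕ → ℕ
when b w = if b then w else 0

count : (ℕ → Bool) → ℕ → ℕ
count P n = ∑[ i < n ] when (P i) 1

InjectiveBelow : ℕ → (ℕ → ℕ) → Set
InjectiveBelow n f = ∀ i j → i < n → j < n → f i ≡ f j → i ≡ j

when-≤ : ∀ b w → when b w ≤ w
when-≤ true  w = ≤-refl
when-≤ false w = z≤n

when-T : ∀ {b} w → T b → when b w ≡ w
when-T {true} w _ = refl

when-¬T : ∀ {b} w → (T b → ⊥) → when b w ≡ 0
when-¬T {false} w _  = refl
when-¬T {true}  w ¬t = ⊥-elim (¬t tt)

when-*-count : ∀ b w → when b w ≡ w * when b 1
when-*-count true  w = sym (*-identityʳ w)
when-*-count false w = sym (*-zeroʳ w)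

count-≤-1 : ∀ t (P : ℕ → Bool) → (∀ i j → i < t → j < t → T (P i) → T (P j) → i ≡ j) → count P t ≤ 1
count-≤-1 zero    P unique = z≤n
count-≤-1 (suc t) P unique with P 0 in P0
... | true  = ≤-reflexive (cong suc (∑-zero t (λ i i<t → when-¬T 1 (λ Pi →
                0≢1+n (unique 0 (suc i) z<s (s<s i<t) (subst T (sym P0) tt) Pi)))))
... | false = count-≤-1 t (λ i → P (suc i))
                (λ i j i<t j<t Pi Pj → suc-injective (unique (suc i) (suc j) (s<s i<t) (s<s j<t) Pi Pj))

count-image-≤ : ∀ t B (f : ℕ → ℕ) (P : ℕ → Bool) → InjectiveBelow t f → (∀ i → i < t → T (P (f i))) →
                count (λ i → f i <ᵇ B) t ≤ count P B
count-image-≤ t zero    f P inj Pf = ≤-reflexive (∑-zero t (λ _ _ → refl))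
count-image-≤ t (suc B) f P inj Pf = begin
  count (λ i → f i <ᵇ suc B) t                                   ≤⟨ ∑-mono-≤ t (λ i _ → split (f i)) ⟩
  ∑[ i < t ] (when (f i <ᵇ B) 1 + when (f i ≡ᵇ B) 1)             ≡⟨ ∑-distrib-+ t _ _ ⟩
  count (λ i → f i <ᵇ B) t + count (λ i → f i ≡ᵇ B) t            ≤⟨ +-mono-≤ (count-image-≤ t B f P inj Pf) hitsB ⟩
  count P B + when (P B) 1                                       ≡⟨ sym (∑-last B _) ⟩
  count P (suc B)                                                ∎
  where
  open ≤-Reasoning
  split : ∀ x → when (x <ᵇ suc B) 1 ≤ when (x <ᵇ B) 1 + when (x ≡ᵇ B) 1
  split x with <-cmp x B
  ... | tri< x<B _ _ = ≤-trans (when-≤ _ 1)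
                         (subst (λ k → 1 ≤ k + when (x ≡ᵇ B) 1) (sym (when-T 1 (<⇒<ᵇ x<B))) (m≤m+n 1 _))
  ... | tri≈ _ refl _ = ≤-trans (when-≤ _ 1)
                          (subst (λ k → 1 ≤ when (x <ᵇ x) 1 + k) (sym (when-T 1 (≡⇒≡ᵇ x x refl))) (m≤n+m 1 _))
  ... | tri> _ _ B<x = ≤-trans (≤-reflexive (when-¬T 1 (λ x<1+B → <⇒≱ B<x (s≤s⁻¹ (<ᵇ⇒< x (suc B) x<1+B))))) z≤n
  hitsB : count (λ i → f i ≡ᵇ B) t ≤ when (P B) 1
  hitsB with P B in PB
  ... | true  = count-≤-1 t _ (λ i j i<t j<t fi≡B fj≡B →
                  inj i j i<t j<t (trans (≡ᵇ⇒≡ _ _ fi≡B) (sym (≡ᵇ⇒≡ _ _ fj≡B))))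
  ... | false = ≤-reflexive (∑-zero t (λ i i<t → when-¬T 1 (λ fi≡B →
                  subst T PB (subst (λ k → T (P k)) (≡ᵇ⇒≡ _ _ fi≡B) (Pf i i<t)))))

injective-≤-count : ∀ t J (f : ℕ → ℕ) (P : ℕ → Bool) → InjectiveBelow t f →
                    (∀ i → i < t → f i < J) → (∀ i → i < t → T (P (f i))) → t ≤ count P J
injective-≤-count t J f P inj f<J Pf = begin
  t                                ≡⟨ sym (∑-count t) ⟩
  ∑[ _ < t ] 1                     ≡⟨ ∑-cong t (λ i i<t → sym (when-T 1 (<⇒<ᵇ (f<J i i<t)))) ⟩
  count (λ i → f i <ᵇ J) t         ≤⟨ count-image-≤ t J f P inj Pf ⟩
  count P J                        ∎
  where open ≤-Reasoning

count-below-≤ : ∀ t B (f : ℕ → ℕ) → InjectiveBelow t f → count (λ i → f i <ᵇ B) t ≤ B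
count-below-≤ t B f inj = begin
  count (λ i → f i <ᵇ B) t   ≤⟨ count-image-≤ t B f (λ _ → true) inj (λ _ _ → tt) ⟩
  ∑[ _ < B ] 1               ≡⟨ ∑-count B ⟩
  B                          ∎
  where open ≤-Reasoning

count-<ᵇ-≤ : ∀ g x → count (λ t → t <ᵇ x) g ≤ x
count-<ᵇ-≤ zero    x       = z≤n
count-<ᵇ-≤ (suc g) zero    = ≤-reflexive (∑-zero (suc g) (λ _ _ → refl))
count-<ᵇ-≤ (suc g) (suc x) = s≤s (count-<ᵇ-≤ g x)

when-<ᵇ-complement : ∀ t x → when (t <ᵇ x) 1 + when (x <ᵇ suc t) 1 ≡ 1
when-<ᵇ-complement t x with <-cmp t x
... | tri< t<x _ _ = cong₂ _+_ (when-T 1 (<⇒<ᵇ t<x))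
                       (when-¬T 1 (λ x<1+t → <⇒≱ t<x (s≤s⁻¹ (<ᵇ⇒< x (suc t) x<1+t))))
... | tri≈ _ refl _ = cong₂ _+_ (when-¬T 1 (λ t<t → <-irrefl refl (<ᵇ⇒< t t t<t))) (when-T 1 (<⇒<ᵇ (n<1+n t)))
... | tri> _ _ x<t = cong₂ _+_ (when-¬T 1 (λ t<x → <-asym x<t (<ᵇ⇒< t x t<x))) (when-T 1 (<⇒<ᵇ (m<n⇒m<1+n x<t)))

-- Each t < g is exceeded by at least g - 1 - t of the distinct values, and summing
-- the indicators [t < u j] over t first gives at most u j.
∑-≥-gauss : ∀ g (u : ℕ → ℕ) → InjectiveBelow g u → ∑[ i < g ] i ≤ ∑ u g
∑-≥-gauss g u inj = begin
  ∑[ i < g ] i                              ≡⟨ sym (∑-countdown g) ⟩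
  ∑[ t < g ] (g ∸ suc t)                    ≤⟨ ∑-mono-≤ g (λ t _ → exceeding t) ⟩
  ∑[ t < g ] count (λ j → t <ᵇ u j) g       ≡⟨ ∑-swap g g (λ t j → when (t <ᵇ u j) 1) ⟩
  ∑[ j < g ] count (λ t → t <ᵇ u j) g       ≤⟨ ∑-mono-≤ g (λ j _ → count-<ᵇ-≤ g (u j)) ⟩
  ∑ u g                                     ∎
  where
  open ≤-Reasoning
  exceeding : ∀ t → g ∸ suc t ≤ count (λ j → t <ᵇ u j) g
  exceeding t = begin
    g ∸ suc t                   ≤⟨ ∸-monoʳ-≤ g (count-below-≤ g (suc t) u inj) ⟩
    g ∸ below                   ≡⟨ cong (_∸ below) partition ⟩
    above + below ∸ below       ≡⟨ m+n∸n≡m above below ⟩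
    above                       ∎
    where
    above = count (λ j → t <ᵇ u j) g
    below = count (λ j → u j <ᵇ suc t) g
    partition : g ≡ above + below
    partition = begin-equality
      g                         ≡⟨ sym (∑-count g) ⟩
      ∑[ _ < g ] 1              ≡⟨ ∑-cong g (λ j _ → sym (when-<ᵇ-complement t (u j))) ⟩
      ∑[ j < g ] (when (t <ᵇ u j) 1 + when (u j <ᵇ suc t) 1) ≡⟨ ∑-distrib-+ g _ _ ⟩
      above + below             ∎

%-+-absorbˡ : ∀ x y m .{{_ : NonZero m}} → (x % m + y) % m ≡ (x + y) % m
%-+-absorbˡ x y m = begin
  (x % m + y) % m              ≡⟨ %-distribˡ-+ (x % m) y m ⟩
  (x % m % m + y % m) % m      ≡⟨ cong (λ z → (z + y % m) % m) (m%n%n≡m%n x m) ⟩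
  (x % m + y % m) % m          ≡⟨ sym (%-distribˡ-+ x y m) ⟩
  (x + y) % m                  ∎
  where open ≡-Reasoning

%-+-absorbʳ : ∀ x y m .{{_ : NonZero m}} → (x + y % m) % m ≡ (x + y) % m
%-+-absorbʳ x y m = begin
  (x + y % m) % m   ≡⟨ cong (_% m) (+-comm x (y % m)) ⟩
  (y % m + x) % m   ≡⟨ %-+-absorbˡ y x m ⟩
  (y + x) % m       ≡⟨ cong (_% m) (+-comm y x) ⟩
  (x + y) % m       ∎
  where open ≡-Reasoning

%-*-absorbʳ : ∀ x y m .{{_ : NonZero m}} → (x * (y % m)) % m ≡ (x * y) % m
%-*-absorbʳ x y m = begin
  (x * (y % m)) % m              ≡⟨ %-distribˡ-* x (y % m) m ⟩
  (x % m * (y % m % m)) % m      ≡⟨ cong (λ z → (x % m * z) % m) (m%n%n≡m%n y m) ⟩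
  (x % m * (y % m)) % m          ≡⟨ sym (%-distribˡ-* x y m) ⟩
  (x * y) % m                    ∎
  where open ≡-Reasoning

%-*-absorbˡ : ∀ x y m .{{_ : NonZero m}} → (x % m * y) % m ≡ (x * y) % m
%-*-absorbˡ x y m = begin
  (x % m * y) % m   ≡⟨ cong (_% m) (*-comm (x % m) y) ⟩
  (y * (x % m)) % m ≡⟨ %-*-absorbʳ y x m ⟩
  (y * x) % m       ≡⟨ cong (_% m) (*-comm y x) ⟩
  (x * y) % m       ∎
  where open ≡-Reasoning

when-∨ : ∀ a b → when (a ∨ b) 1 ≤ when a 1 + when b 1
when-∨ true  b = s≤s z≤n
when-∨ false b = ≤-refl

occupied-count-≤ : ∀ m occ → count (occupied occ) m ≤ length occ
occupied-count-≤ m []        = ≤-reflexive (∑-zero m (λ _ _ → refl))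
occupied-count-≤ m (x ∷ occ) = begin
  count (λ p → (x ≡ᵇ p) ∨ occupied occ p) m                ≤⟨ ∑-mono-≤ m (λ p _ → when-∨ (x ≡ᵇ p) (occupied occ p)) ⟩
  ∑[ p < m ] (when (x ≡ᵇ p) 1 + when (occupied occ p) 1)   ≡⟨ ∑-distrib-+ m _ _ ⟩
  count (x ≡ᵇ_) m + count (occupied occ) m                 ≤⟨ +-mono-≤ atMostOneCell (occupied-count-≤ m occ) ⟩
  suc (length occ)                                         ∎
  where
  open ≤-Reasoning
  atMostOneCell : count (x ≡ᵇ_) m ≤ 1
  atMostOneCell = count-≤-1 m (x ≡ᵇ_) (λ i j _ _ x≡i x≡j → trans (sym (≡ᵇ⇒≡ x i x≡i)) (≡ᵇ⇒≡ x j x≡j))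

module LinearProbing (ℓout : ℕ) where

  m : ℕ
  m = pow2 ℓout

  instance
    m≢0 : NonZero m
    m≢0 = m^n≢0 2 ℓout

  Placed : List ℕ → ℕ → ℕ × ℕ → Set
  Placed occ pos r = 1 ≤ proj₁ r × proj₂ r ≡ (pos + (proj₁ r ∸ 1)) % m × occupied occ (proj₂ r) ≡ false

  probe-placed-or-full : ∀ occ fuel pos → pos < m →
    Placed occ pos (probe ℓout occ fuel pos) ⊎ (∀ i → i < fuel → occupied occ ((pos + i) % m) ≡ true)
  probe-placed-or-full occ zero       pos pos<m = inj₂ (λ i ())
  probe-placed-or-full occ (suc fuel) pos pos<m with occupied occ pos in posOcc
  ... | false = inj₁ (s≤s z≤n , sym (trans (cong (_% m) (+-identityʳ pos)) (m<n⇒m%n≡m pos<m)) , posOcc)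
  ... | true with probe-placed-or-full occ fuel (suc pos % m) (m%n<n (suc pos) m)
  ...   | inj₁ (cost≥1 , cell≡ , free) = inj₁ (s≤s z≤n , trans cell≡ shift , free)
    where
    cost = proj₁ (probe ℓout occ fuel (suc pos % m))
    shift : (suc pos % m + (cost ∸ 1)) % m ≡ (pos + (suc cost ∸ 1)) % m
    shift = begin
      (suc pos % m + (cost ∸ 1)) % m  ≡⟨ %-+-absorbˡ (suc pos) (cost ∸ 1) m ⟩
      (suc pos + (cost ∸ 1)) % m      ≡⟨ cong (_% m) (sym (+-suc pos (cost ∸ 1))) ⟩
      (pos + suc (cost ∸ 1)) % m      ≡⟨ cong (λ k → (pos + k) % m) (suc-pred cost {{>-nonZero cost≥1}}) ⟩
      (pos + cost) % m                ∎
      where open ≡-Reasoning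
  ...   | inj₂ full = inj₂ fullFromPos
    where
    fullFromPos : ∀ i → i < suc fuel → occupied occ ((pos + i) % m) ≡ true
    fullFromPos zero    _ =
      trans (cong (occupied occ) (trans (cong (_% m) (+-identityʳ pos)) (m<n⇒m%n≡m pos<m))) posOcc
    fullFromPos (suc i) (s≤s i<fuel) =
      trans (cong (occupied occ) (trans (cong (_% m) (+-suc pos i)) (sym (%-+-absorbˡ (suc pos) i m))))
            (full i i<fuel)

  full⇒m≤length : ∀ occ pos → pos < m → (∀ i → i < m → occupied occ ((pos + i) % m) ≡ true) → m ≤ length occ
  full⇒m≤length occ pos pos<m full = begin
    m                        ≡⟨ sym (∑-count m) ⟩
    ∑[ _ < m ] 1             ≡⟨ ∑-cong m (λ p p<m → sym (cong (λ b → when b 1) (reached p p<m))) ⟩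
    count (occupied occ) m   ≤⟨ occupied-count-≤ m occ ⟩
    length occ               ∎
    where
    open ≤-Reasoning
    reached : ∀ p → p < m → occupied occ p ≡ true
    reached p p<m = trans (cong (occupied occ) (sym wraps)) (full i (m%n<n _ m))
      where
      i = (p + (m ∸ pos)) % m
      wraps : (pos + i) % m ≡ p
      wraps = begin-equality
        (pos + i) % m                   ≡⟨ %-+-absorbʳ pos (p + (m ∸ pos)) m ⟩
        (pos + (p + (m ∸ pos))) % m   ≡⟨ cong (_% m) (rotate pos p (m ∸ pos)) ⟩
        (p + (m ∸ pos + pos)) % m     ≡⟨ cong (λ k → (p + k) % m) (m∸n+n≡m (<⇒≤ pos<m)) ⟩
        (p + m) % m                       ≡⟨ [m+n]%n≡m%n p m ⟩
        p % m                             ≡⟨ m<n⇒m%n≡m p<m ⟩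
        p                                 ∎
        where
        rotate : ∀ a b c → a + (b + c) ≡ b + (c + a)
        rotate = solve-∀

  probe-placed : ∀ occ pos → pos < m → length occ < m → Placed occ pos (probe ℓout occ m pos)
  probe-placed occ pos pos<m short with probe-placed-or-full occ m pos pos<m
  ... | inj₁ placed = placed
  ... | inj₂ full   = ⊥-elim (<⇒≱ short (full⇒m≤length occ pos pos<m full))

  module Insertion (h : ℕ → ℕ) (h<m : ∀ x → h x < m) where

    table : ℕ → List ℕ
    table zero    = []
    table (suc k) = proj₂ (probe ℓout (table k) m (h k)) ∷ table k

    cost : ℕ → ℕ
    cost k = proj₁ (probe ℓout (table k) m (h k))

    cell : ℕ → ℕ
    cell k = proj₂ (probe ℓout (table k) m (h k))

    length-table : ∀ k → length (table k) ≡ k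
    length-table zero    = refl
    length-table (suc k) = cong suc (length-table k)

    placed : ∀ k → k < m → Placed (table k) (h k) (probe ℓout (table k) m (h k))
    placed k k<m = probe-placed (table k) (h k) (h<m k) (subst (_< m) (sym (length-table k)) k<m)

    cost≥1 : ∀ k → k < m → 1 ≤ cost k
    cost≥1 k k<m = proj₁ (placed k k<m)

    cell≡ : ∀ k → k < m → cell k ≡ (h k + (cost k ∸ 1)) % m
    cell≡ k k<m = proj₁ (proj₂ (placed k k<m))

    cell-free : ∀ k → k < m → occupied (table k) (cell k) ≡ false
    cell-free k k<m = proj₂ (proj₂ (placed k k<m))

    cell-occupied : ∀ i k → i < k → occupied (table k) (cell i) ≡ true
    cell-occupied i (suc k) i<1+k with m≤n⇒m<n∨m≡n (s≤s⁻¹ i<1+k)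
    ... | inj₁ i<k  = trans (cong ((cell k ≡ᵇ cell i) ∨_) (cell-occupied i k i<k)) (∨-zeroʳ (cell k ≡ᵇ cell i))
    ... | inj₂ refl = cong (_∨ occupied (table i) (cell i)) (≡ᵇ-refl (cell i))
      where
      ≡ᵇ-refl : ∀ x → (x ≡ᵇ x) ≡ true
      ≡ᵇ-refl zero    = refl
      ≡ᵇ-refl (suc x) = ≡ᵇ-refl x

    cell-injective : InjectiveBelow m cell
    cell-injective i j i<m j<m same with <-cmp i j
    ... | tri≈ _ i≡j _ = i≡j
    ... | tri< i<j _ _ = ⊥-elim (case (begin
            false                        ≡⟨ sym (cell-free j j<m) ⟩
            occupied (table j) (cell j)  ≡⟨ cong (occupied (table j)) (sym same) ⟩
            occupied (table j) (cell i)  ≡⟨ cell-occupied i j i<j ⟩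
            true                         ∎) of λ ())
      where open ≡-Reasoning
    ... | tri> _ _ j<i = ⊥-elim (case (begin
            false                        ≡⟨ sym (cell-free i i<m) ⟩
            occupied (table i) (cell i)  ≡⟨ cong (occupied (table i)) same ⟩
            occupied (table i) (cell j)  ≡⟨ cell-occupied j i j<i ⟩
            true                         ∎) of λ ())
      where open ≡-Reasoning

    insertAll≡∑cost : ∀ len k (f : ℕ → ℕ) → (∀ i → f i ≡ k + i) →
                      insertAll ℓout h (table k) (applyUpTo f len) ≡ ∑[ i < len ] cost (k + i)
    insertAll≡∑cost zero      k f f≡ = refl
    insertAll≡∑cost (suc len) k f f≡ with f 0 | f≡ 0
    ... | .(k + 0) | refl rewrite +-identityʳ k =
      cong (cost k +_) (trans (insertAll≡∑cost len (suc k) (λ i → f (suc i)) (λ i → trans (f≡ (suc i)) (+-suc k i)))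
                              (∑-cong len (λ i _ → cong cost (sym (+-suc k i)))))

first-satisfying : ∀ K (P : ℕ → Bool) → (∀ i → i < K → P i ≡ false) ⊎
                   Σ ℕ (λ i₀ → i₀ < K × T (P i₀) × (∀ i → i < i₀ → P i ≡ false))
first-satisfying zero    P = inj₁ (λ i ())
first-satisfying (suc K) P with first-satisfying K P
... | inj₂ (i₀ , i₀<K , P-i₀ , before) = inj₂ (i₀ , m<n⇒m<1+n i₀<K , P-i₀ , before)
... | inj₁ none with P K in PK
...   | true  = inj₂ (K , n<1+n K , subst T (sym PK) tt , none)
...   | false = inj₁ noneBelow1+K
  where
  noneBelow1+K : ∀ i → i < suc K → P i ≡ false
  noneBelow1+K i i<1+K with m≤n⇒m<n∨m≡n (s≤s⁻¹ i<1+K)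
  ... | inj₁ i<K  = none i i<K
  ... | inj₂ refl = PK

telescope : ∀ (P : ℕ → Bool) (y w : ℕ → ℕ) B i₀ → T (P i₀) → (∀ i → i < i₀ → P i ≡ false) →
  (∀ i j → i < j → T (P i) → T (P j) → y i₀ * w j + B * y i ≤ B * y j) →
  ∀ d → Σ ℕ (λ l → l < suc i₀ + d × T (P l) ×
          y i₀ * ∑[ i < suc i₀ + d ] when (P i) (w i) + B * y i₀ ≤ y i₀ * w i₀ + B * y l)
telescope P y w B i₀ P-i₀ before gap zero =
  i₀ , subst (i₀ <_) (sym (+-identityʳ (suc i₀))) (n<1+n i₀) , P-i₀ ,
  ≤-reflexive (cong (λ z → y i₀ * z + B * y i₀) onlyFirst)
  where
  onlyFirst : ∑[ i < suc i₀ + 0 ] when (P i) (w i) ≡ w i₀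
  onlyFirst = begin
    ∑[ i < suc i₀ + 0 ] when (P i) (w i)                   ≡⟨ cong (λ k → ∑[ i < k ] when (P i) (w i)) (+-identityʳ (suc i₀)) ⟩
    ∑[ i < suc i₀ ] when (P i) (w i)                       ≡⟨ ∑-last i₀ _ ⟩
    ∑[ i < i₀ ] when (P i) (w i) + when (P i₀) (w i₀)      ≡⟨ cong₂ _+_ (∑-zero i₀ (λ i i<i₀ → cong (λ b → when b (w i)) (before i i<i₀)))
                                                                          (when-T (w i₀) P-i₀) ⟩
    w i₀                                                   ∎
    where open ≡-Reasoning
telescope P y w B i₀ P-i₀ before gap (suc d) = extend (telescope P y w B i₀ P-i₀ before gap d)
  where
  open ≤-Reasoning
  b = suc i₀ + d
  F = λ k → ∑[ i < k ] when (P i) (w i)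
  b<b′ : b < suc i₀ + suc d
  b<b′ = subst (b <_) (sym (+-suc (suc i₀) d)) (n<1+n b)
  F-next : ∀ v → P b ≡ v → F (suc i₀ + suc d) ≡ F b + when v (w b)
  F-next v Pb≡v = trans (cong F (+-suc (suc i₀) d))
                        (trans (∑-last b (λ i → when (P i) (w i))) (cong (λ v → F b + when v (w b)) Pb≡v))
  regroup : ∀ a b c d → a * (b + c) + d ≡ (a * b + d) + a * c
  regroup = solve-∀
  regroup′ : ∀ a b c → (a + b) + c ≡ a + (c + b)
  regroup′ = solve-∀
  extend : Σ ℕ (λ l → l < b × T (P l) × y i₀ * F b + B * y i₀ ≤ y i₀ * w i₀ + B * y l) →
           Σ ℕ (λ l → l < suc i₀ + suc d × T (P l) × y i₀ * F (suc i₀ + suc d) + B * y i₀ ≤ y i₀ * w i₀ + B * y l)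
  extend (l , l<b , P-l , ih) with P b in Pb
  ... | false = l , <-trans l<b b<b′ , P-l , (begin
        y i₀ * F (suc i₀ + suc d) + B * y i₀         ≡⟨ cong (λ z → y i₀ * z + B * y i₀) (trans (F-next false Pb) (+-identityʳ _)) ⟩
        y i₀ * F b + B * y i₀                        ≤⟨ ih ⟩
        y i₀ * w i₀ + B * y l                        ∎)
  ... | true = b , b<b′ , subst T (sym Pb) tt , (begin
        y i₀ * F (suc i₀ + suc d) + B * y i₀         ≡⟨ cong (λ z → y i₀ * z + B * y i₀) (F-next true Pb) ⟩
        y i₀ * (F b + w b) + B * y i₀                ≡⟨ regroup (y i₀) (F b) (w b) (B * y i₀) ⟩
        (y i₀ * F b + B * y i₀) + y i₀ * w b         ≤⟨ +-monoˡ-≤ (y i₀ * w b) ih ⟩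
        (y i₀ * w i₀ + B * y l) + y i₀ * w b         ≡⟨ regroup′ (y i₀ * w i₀) (B * y l) (y i₀ * w b) ⟩
        y i₀ * w i₀ + (y i₀ * w b + B * y l)         ≤⟨ +-monoʳ-≤ (y i₀ * w i₀) (gap l b l<b P-l (subst T (sym Pb) tt)) ⟩
        y i₀ * w i₀ + B * y b                        ∎)

-- The gap hypothesis says w j ≤ B (y j - y i) / y j, so the selected weights telescope to at
-- most w first + B (y last - y first) / y first ≤ ρ B.
telescoping-≤ : ∀ K (P : ℕ → Bool) (y w : ℕ → ℕ) B ρ →
  (∀ i → 1 ≤ y i) → (∀ i j → i ≤ j → y i ≤ y j) →
  (∀ i → T (P i) → w i ≤ B) →
  (∀ i j → i < j → T (P i) → T (P j) → y j * w j + B * y i ≤ B * y j) →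
  (∀ i j → T (P i) → T (P j) → y j ≤ ρ * y i) →
  ∑[ i < K ] when (P i) (w i) ≤ ρ * B
telescoping-≤ K P y w B ρ y≥1 y-mono w≤B gap spread with first-satisfying K P
... | inj₁ none = ≤-trans (≤-reflexive (∑-zero K (λ i i<K → cong (λ b → when b (w i)) (none i i<K)))) z≤n
... | inj₂ (i₀ , i₀<K , P-i₀ , before) with telescope P y w B i₀ P-i₀ before gap′ (K ∸ suc i₀)
  where
  gap′ : ∀ i j → i < j → T (P i) → T (P j) → y i₀ * w j + B * y i ≤ B * y j
  gap′ i j i<j P-i P-j = ≤-trans (+-monoˡ-≤ (B * y i) (*-monoˡ-≤ (w j) (y-mono i₀ j i₀≤j))) (gap i j i<j P-i P-j)
    where
    i₀≤j : i₀ ≤ j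
    i₀≤j with <-cmp i₀ j
    ... | tri< i₀<j _ _ = <⇒≤ i₀<j
    ... | tri≈ _ refl _ = ≤-refl
    ... | tri> _ _ j<i₀ = ⊥-elim (subst T (before j j<i₀) P-j)
... | l , _ , P-l , telescoped = *-cancelˡ-≤ (y i₀) {{>-nonZero (y≥1 i₀)}} (+-cancelʳ-≤ (B * y i₀) _ _ (begin
    y i₀ * F K + B * y i₀                           ≡⟨ cong (λ k → y i₀ * F k + B * y i₀) (sym (m+[n∸m]≡n i₀<K)) ⟩
    y i₀ * F (suc i₀ + (K ∸ suc i₀)) + B * y i₀     ≤⟨ telescoped ⟩
    y i₀ * w i₀ + B * y l                           ≤⟨ +-mono-≤ (*-monoʳ-≤ (y i₀) (w≤B i₀ P-i₀)) (*-monoʳ-≤ B (spread i₀ l P-i₀ P-l)) ⟩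
    y i₀ * B + B * (ρ * y i₀)                       ≡⟨ regroup (y i₀) B ρ ⟩
    y i₀ * (ρ * B) + B * y i₀                       ∎))
  where
  open ≤-Reasoning
  F = λ k → ∑[ i < k ] when (P i) (w i)
  regroup : ∀ y B ρ → y * B + B * (ρ * y) ≡ y * (ρ * B) + B * y
  regroup = solve-∀

odd : ℕ → ℕ
odd i = suc (2 * i)

inWindow : ℕ → ℕ → Bool
inWindow s e = (s <ᵇ 16 * e) ∧ (2 * e ≤ᵇ s)

module MultiplicativeHashing (ℓ ℓout a : ℕ) (ℓout≤ℓ : ℓout ≤ ℓ) where

  open LinearProbing ℓout public

  M s : ℕ
  M = pow2 ℓ
  s = pow2 (ℓ ∸ ℓout)

  instance
    M≢0 : NonZero M
    M≢0 = m^n≢0 2 ℓ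
    s≢0 : NonZero s
    s≢0 = m^n≢0 2 (ℓ ∸ ℓout)

  M≡m*s : M ≡ m * s
  M≡m*s = trans (cong (2 ^_) (sym (m+[n∸m]≡n ℓout≤ℓ))) (^-distribˡ-+-* 2 ℓout (ℓ ∸ ℓout))

  E : ℕ → ℕ
  E x = (a * x) % M

  hash<m : ∀ x → hash ℓ ℓout a x < m
  hash<m x = m<n*o⇒m/o<n (subst (E x <_) M≡m*s (m%n<n (a * x) M))

  %M/s≡/s%m : ∀ y → (y % M) / s ≡ (y / s) % m
  %M/s≡/s%m y = helper M M≡m*s
    where
    helper : ∀ K .{{_ : NonZero K}} → K ≡ m * s → (y % K) / s ≡ (y / s) % m
    helper .(m * s) refl = m%[n*o]/o≡m/o%n y m s {{_}} {{_}} {{m*n≢0 m s}}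

  open Insertion (hash ℓ ℓout a) hash<m public

  module Progression (q r : ℕ) where

    key : ℕ → ℕ
    key j = j * q + r

    step offset base : ℕ
    step   = E q
    offset = E r
    base   = offset / s

    unwrapped drift displacement : ℕ → ℕ
    unwrapped j    = (offset + j * step) / s
    drift j        = unwrapped j ∸ base
    displacement j = drift j + (cost (key j) ∸ 1)

    E-key : ∀ j → E (key j) ≡ (offset + j * step) % M
    E-key j = begin
      (a * (j * q + r)) % M                ≡⟨ cong (_% M) (expand a q r j) ⟩
      (a * r + j * (a * q)) % M            ≡⟨ sym (%-+-absorbˡ (a * r) _ M) ⟩
      (offset + j * (a * q)) % M           ≡⟨ sym (%-+-absorbʳ offset _ M) ⟩
      (offset + (j * (a * q)) % M) % M     ≡⟨ cong (λ z → (offset + z) % M) (sym (%-*-absorbʳ j (a * q) M)) ⟩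
      (offset + (j * step) % M) % M        ≡⟨ %-+-absorbʳ offset (j * step) M ⟩
      (offset + j * step) % M              ∎
      where
      open ≡-Reasoning
      expand : ∀ a q r j → a * (j * q + r) ≡ a * r + j * (a * q)
      expand = solve-∀

    base≤unwrapped : ∀ j → base ≤ unwrapped j
    base≤unwrapped j = /-monoˡ-≤ s (m≤m+n offset (j * step))

    cell-key : ∀ j → key j < m → cell (key j) ≡ (base + displacement j) % m
    cell-key j key<m = begin
      cell (key j)                                      ≡⟨ cell≡ (key j) key<m ⟩
      (E (key j) / s + (cost (key j) ∸ 1)) % m          ≡⟨ cong (λ z → (z / s + (cost (key j) ∸ 1)) % m) (E-key j) ⟩
      ((offset + j * step) % M / s + (cost (key j) ∸ 1)) % m
                                                        ≡⟨ cong (λ z → (z + (cost (key j) ∸ 1)) % m) (%M/s≡/s%m _) ⟩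
      (unwrapped j % m + (cost (key j) ∸ 1)) % m        ≡⟨ %-+-absorbˡ (unwrapped j) _ m ⟩
      (unwrapped j + (cost (key j) ∸ 1)) % m            ≡⟨ cong (λ z → (z + (cost (key j) ∸ 1)) % m) (sym (m+[n∸m]≡n (base≤unwrapped j))) ⟩
      (base + drift j + (cost (key j) ∸ 1)) % m         ≡⟨ cong (_% m) (+-assoc base (drift j) _) ⟩
      (base + displacement j) % m                       ∎
      where open ≡-Reasoning

    displacement-injective : ∀ g → 1 ≤ q → (∀ j → j < g → key j < m) → InjectiveBelow g displacement
    displacement-injective g q≥1 key<m i j i<g j<g same =
      *-cancelʳ-≡ i j q {{>-nonZero q≥1}} (+-cancelʳ-≡ r (i * q) (j * q) (cell-injective _ _ (key<m i i<g) (key<m j j<g) sameCell))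
      where
      sameCell : cell (key i) ≡ cell (key j)
      sameCell = trans (cell-key i (key<m i i<g)) (trans (cong (λ z → (base + z) % m) same) (sym (cell-key j (key<m j j<g))))

    drift-bound : ∀ j → 2 * step ≤ s → 2 * drift j ≤ j + 1
    drift-bound j short = s≤s⁻¹ (subst (suc (2 * drift j) ≤_) (+-suc j 1) (*-cancelʳ-< s (2 * drift j) (j + 2) scaled))
      where
      open ≤-Reasoning
      unscaled : drift j * s < s + j * step
      unscaled = +-cancelʳ-< (base * s) (drift j * s) (s + j * step) (begin-strict
        drift j * s + base * s          ≡⟨ sym (*-distribʳ-+ s (drift j) base) ⟩
        (drift j + base) * s            ≡⟨ cong (_* s) (m∸n+n≡m (base≤unwrapped j)) ⟩
        unwrapped j * s                 ≤⟨ m/n*n≤m (offset + j * step) s ⟩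
        offset + j * step               <⟨ +-monoˡ-< (j * step) (m<[m/n+1]*n offset) ⟩
        (base + 1) * s + j * step       ≡⟨ regroup base s (j * step) ⟩
        s + j * step + base * s         ∎)
        where
        m<[m/n+1]*n : ∀ c → c < (c / s + 1) * s
        m<[m/n+1]*n c = begin-strict
          c                       ≡⟨ m≡m%n+[m/n]*n c s ⟩
          c % s + c / s * s       <⟨ +-monoˡ-< (c / s * s) (m%n<n c s) ⟩
          s + c / s * s           ≡⟨ +-comm s (c / s * s) ⟩
          c / s * s + s           ≡⟨ sym (trans (*-distribʳ-+ s (c / s) 1) (cong (c / s * s +_) (*-identityˡ s))) ⟩
          (c / s + 1) * s         ∎
        regroup : ∀ b s x → (b + 1) * s + x ≡ s + x + b * s
        regroup = solve-∀
      scaled : 2 * drift j * s < (j + 2) * s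
      scaled = begin-strict
        2 * drift j * s         ≡⟨ *-assoc 2 (drift j) s ⟩
        2 * (drift j * s)       <⟨ *-monoʳ-< 2 unscaled ⟩
        2 * (s + j * step)      ≡⟨ expand s j step ⟩
        2 * s + j * (2 * step)  ≤⟨ +-monoʳ-≤ (2 * s) (*-monoʳ-≤ j short) ⟩
        2 * s + j * s           ≡⟨ collect s j ⟩
        (j + 2) * s             ∎
        where
        expand : ∀ s j e → 2 * (s + j * e) ≡ 2 * s + j * (2 * e)
        expand = solve-∀
        collect : ∀ s j → 2 * s + j * s ≡ (j + 2) * s
        collect = solve-∀

    -- The g displacements are distinct (∑ ≥ 0 + ⋯ + (g-1)) while the drifts are only
    -- about even-or-odd as large, so the costs make up the difference.
    progression-cost : ∀ g → 1 ≤ q → (∀ j → j < g → key j < m) → 2 * step ≤ s →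
                       g * g + g ≤ 4 * ∑[ j < g ] cost (key j)
    progression-cost g q≥1 key<m short = begin
      g * g + g              ≡⟨ cong (_+ g) (sym (∑-gauss g)) ⟩
      2 * I + g + g          ≡⟨ double I g ⟩
      2 * (I + g)            ≤⟨ *-monoʳ-≤ 2 I+g≤2C ⟩
      2 * (2 * C)            ≡⟨ sym (*-assoc 2 2 C) ⟩
      4 * C                  ∎
      where
      open ≤-Reasoning
      I = ∑[ i < g ] i
      U = ∑ displacement g
      D = ∑ drift g
      C = ∑[ j < g ] cost (key j)
      double : ∀ I g → 2 * I + g + g ≡ 2 * (I + g)
      double = solve-∀
      U+g≡D+C : U + g ≡ D + C
      U+g≡D+C = begin-equality
        U + g                                   ≡⟨ cong (U +_) (sym (∑-count g)) ⟩
        U + ∑[ _ < g ] 1                        ≡⟨ sym (∑-distrib-+ g displacement (λ _ → 1)) ⟩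
        ∑[ j < g ] (displacement j + 1)         ≡⟨ ∑-cong g (λ j j<g → trans (+-assoc (drift j) _ 1)
                                                     (cong (drift j +_) (m∸n+n≡m (cost≥1 _ (key<m j j<g))))) ⟩
        ∑[ j < g ] (drift j + cost (key j))     ≡⟨ ∑-distrib-+ g drift _ ⟩
        D + C                                   ∎
      2D≤I+g : 2 * D ≤ I + g
      2D≤I+g = begin
        2 * D                        ≡⟨ sym (∑-*ˡ g 2 drift) ⟩
        ∑[ j < g ] (2 * drift j)     ≤⟨ ∑-mono-≤ g (λ j _ → drift-bound j short) ⟩
        ∑[ j < g ] (j + 1)           ≡⟨ ∑-distrib-+ g (λ j → j) (λ _ → 1) ⟩
        I + ∑[ _ < g ] 1             ≡⟨ cong (I +_) (∑-count g) ⟩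
        I + g                        ∎
      I+g≤2C : I + g ≤ 2 * C
      I+g≤2C = +-cancelˡ-≤ (I + g) (I + g) (2 * C) (begin
        (I + g) + (I + g)       ≡⟨ solve-twice I g ⟩
        2 * I + 2 * g           ≤⟨ +-monoˡ-≤ (2 * g) (*-monoʳ-≤ 2 (∑-≥-gauss g displacement (displacement-injective g q≥1 key<m))) ⟩
        2 * U + 2 * g           ≡⟨ sym (*-distribˡ-+ 2 U g) ⟩
        2 * (U + g)             ≡⟨ cong (2 *_) U+g≡D+C ⟩
        2 * (D + C)             ≡⟨ *-distribˡ-+ 2 D C ⟩
        2 * D + 2 * C           ≤⟨ +-monoˡ-≤ (2 * C) 2D≤I+g ⟩
        (I + g) + 2 * C         ∎)
        where
        solve-twice : ∀ I g → (I + g) + (I + g) ≡ 2 * I + 2 * g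
        solve-twice = solve-∀

  -- Splitting the first n keys into q residue classes mod q, each an arithmetic
  -- progression of about n/q keys with step E q.
  ∑cost-≥ : ∀ n q → n < m → 1 ≤ q → 4 * q ≤ n → 2 * E q ≤ s → n * n ≤ 16 * q * ∑ cost n
  ∑cost-≥ n q n<m q≥1 4q≤n short = begin
    n * n                                        ≤⟨ *-mono-≤ n≤2gq n≤2gq ⟩
    (2 * (g * q)) * (2 * (g * q))                ≡⟨ regroup g q ⟩
    4 * q * (q * (g * g))                        ≤⟨ *-monoʳ-≤ (4 * q) (*-monoʳ-≤ q (m≤m+n (g * g) g)) ⟩
    4 * q * (q * (g * g + g))                    ≡⟨ cong (4 * q *_) (sym (∑-const q (g * g + g))) ⟩
    4 * q * ∑[ _ < q ] (g * g + g)               ≤⟨ *-monoʳ-≤ (4 * q) (∑-mono-≤ q (λ r r<q →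
                                                      Progression.progression-cost q r g q≥1 (key<m r r<q) short)) ⟩
    4 * q * ∑[ r < q ] (4 * ∑[ j < g ] cost (j * q + r))
                                                 ≡⟨ cong (4 * q *_) (∑-*ˡ q 4 _) ⟩
    4 * q * (4 * ∑[ r < q ] ∑[ j < g ] cost (j * q + r))
                                                 ≡⟨ cong (λ z → 4 * q * (4 * z)) (sym (∑-swap g q (λ j r → cost (j * q + r)))) ⟩
    4 * q * (4 * ∑[ j < g ] ∑[ r < q ] cost (j * q + r))
                                                 ≡⟨ cong (λ z → 4 * q * (4 * z)) (sym (∑-blocks g q cost)) ⟩
    4 * q * (4 * ∑ cost (g * q))                 ≤⟨ *-monoʳ-≤ (4 * q) (*-monoʳ-≤ 4 (∑-mono-length cost gq≤n)) ⟩
    4 * q * (4 * ∑ cost n)                       ≡⟨ regroup′ q (∑ cost n) ⟩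
    16 * q * ∑ cost n                            ∎
    where
    open ≤-Reasoning
    instance
      q≢0 : NonZero q
      q≢0 = >-nonZero q≥1
    g = n / q
    gq≤n : g * q ≤ n
    gq≤n = m/n*n≤m n q
    key<m : ∀ r → r < q → ∀ j → j < g → j * q + r < m
    key<m r r<q j j<g = <-trans (begin-strict
      j * q + r    <⟨ +-monoʳ-< (j * q) r<q ⟩
      j * q + q    ≡⟨ +-comm (j * q) q ⟩
      suc j * q    ≤⟨ *-monoˡ-≤ q j<g ⟩
      g * q        ≤⟨ gq≤n ⟩
      n            ∎) n<m
    n≤2gq : n ≤ 2 * (g * q)
    n≤2gq = <⇒≤ (+-cancelˡ-< n n (2 * (g * q)) (begin-strict
      n + n                          <⟨ +-mono-< n<q+gq n<q+gq ⟩
      (q + g * q) + (q + g * q)      ≡⟨ double q (g * q) ⟩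
      2 * q + 2 * (g * q)            ≤⟨ +-monoˡ-≤ (2 * (g * q)) (≤-trans (*-monoˡ-≤ q (s≤s (s≤s (z≤n {2})))) 4q≤n) ⟩
      n + 2 * (g * q)                ∎))
      where
      n<q+gq : n < q + g * q
      n<q+gq = subst (_< q + g * q) (sym (m≡m%n+[m/n]*n n q)) (+-monoˡ-< (g * q) (m%n<n n q))
      double : ∀ x y → (x + y) + (x + y) ≡ 2 * x + 2 * y
      double = solve-∀
    regroup : ∀ g q → (2 * (g * q)) * (2 * (g * q)) ≡ 4 * q * (q * (g * g))
    regroup = solve-∀
    regroup′ : ∀ q x → 4 * q * (4 * x) ≡ 16 * q * x
    regroup′ = solve-∀

  E*<M : ∀ u v → 2 * E u ≤ s → v < m → E u * v < M
  E*<M u v short-u v<m = begin-strict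
    E u * v      ≤⟨ *-monoˡ-≤ v (m≤n*m (E u) 2) ⟩
    2 * E u * v  ≤⟨ *-monoˡ-≤ v short-u ⟩
    s * v        <⟨ *-monoʳ-< s v<m ⟩
    s * m        ≡⟨ trans (*-comm s m) (sym M≡m*s) ⟩
    M            ∎
    where open ≤-Reasoning

  -- For steps below s/2 the products a x y and a y x do not wrap around modulo M.
  E-swap : ∀ x y → x < m → y < m → 2 * E x ≤ s → 2 * E y ≤ s → E x * y ≡ E y * x
  E-swap x y x<m y<m short-x short-y = begin
    E x * y          ≡⟨ sym (m<n⇒m%n≡m (E*<M x y short-x y<m)) ⟩
    (E x * y) % M    ≡⟨ %-*-absorbˡ (a * x) y M ⟩
    (a * x * y) % M  ≡⟨ cong (_% M) (swap a x y) ⟩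
    (a * y * x) % M  ≡⟨ sym (%-*-absorbˡ (a * y) x M) ⟩
    (E y * x) % M    ≡⟨ m<n⇒m%n≡m (E*<M y x short-y x<m) ⟩
    E y * x          ∎
    where
    open ≡-Reasoning
    swap : ∀ a x y → a * x * y ≡ a * y * x
    swap = solve-∀

  E-mono : ∀ x y → x < y → y < m → 2 * E x ≤ s → 2 * E y ≤ s → E x ≤ E y
  E-mono x y x<y y<m short-x short-y = *-cancelʳ-≤ (E x) (E y) y {{>-nonZero (≤-<-trans z≤n x<y)}} (begin
    E x * y   ≡⟨ E-swap x y (<-trans x<y y<m) y<m short-x short-y ⟩
    E y * x   ≤⟨ *-monoʳ-≤ (E y) (<⇒≤ x<y) ⟩
    E y * y   ∎)
    where open ≤-Reasoning

  window-ratio : ∀ x y → 1 ≤ x → x < m → y < m → s < 16 * E x → 2 * E x ≤ s → 2 * E y ≤ s → y ≤ 8 * x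
  window-ratio x y x≥1 x<m y<m wide-x short-x short-y = <⇒≤ (*-cancelʳ-< (E x) y (8 * x) (begin-strict
    y * E x          ≡⟨ *-comm y (E x) ⟩
    E x * y          ≡⟨ E-swap x y x<m y<m short-x short-y ⟩
    E y * x          <⟨ *-monoˡ-< x {{>-nonZero x≥1}} Ey<8Ex ⟩
    8 * E x * x      ≡⟨ regroup (E x) x ⟩
    8 * x * E x      ∎))
    where
    open ≤-Reasoning
    regroup : ∀ e x → 8 * e * x ≡ 8 * x * e
    regroup = solve-∀
    Ey<8Ex : E y < 8 * E x
    Ey<8Ex = *-cancelˡ-< 2 (E y) (8 * E x) (≤-<-trans short-y (subst (s <_) (*-assoc 2 8 (E x)) wide-x))

  E-+-∸ : ∀ x y → x ≤ y → (E x + E (y ∸ x)) % M ≡ E y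
  E-+-∸ x y x≤y = trans (sym (%-distribˡ-+ (a * x) (a * (y ∸ x)) M))
                        (cong (_% M) (trans (sym (*-distribˡ-+ a x (y ∸ x))) (cong (a *_) (m+[n∸m]≡n x≤y))))

  short-difference : ∀ x y → x < y → y < m → 2 * E x ≤ s → 2 * E y ≤ s → 2 * E (y ∸ x) ≤ s
  short-difference x y x<y y<m short-x short-y with E x + E (y ∸ x) <? M
  ... | yes no-wrap = ≤-trans (*-monoʳ-≤ 2 (subst (E (y ∸ x) ≤_) Ex+Ed≡Ey (m≤n+m _ _))) short-y
    where
    Ex+Ed≡Ey : E x + E (y ∸ x) ≡ E y
    Ex+Ed≡Ey = trans (sym (m<n⇒m%n≡m no-wrap)) (E-+-∸ x y (<⇒≤ x<y))
  ... | no wrap = ⊥-elim (<⇒≱ (m%n<n (a * (y ∸ x)) M) (+-cancelˡ-≤ (E x) M (E (y ∸ x)) (begin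
      E x + M                  ≤⟨ +-monoˡ-≤ M (E-mono x y x<y y<m short-x short-y) ⟩
      E y + M                  ≡⟨ cong (_+ M) Ey≡ ⟩
      E x + E (y ∸ x) ∸ M + M  ≡⟨ m∸n+n≡m M≤sum ⟩
      E x + E (y ∸ x)          ∎)))
    where
    open ≤-Reasoning
    M≤sum : M ≤ E x + E (y ∸ x)
    M≤sum = ≮⇒≥ wrap
    Ey≡ : E y ≡ E x + E (y ∸ x) ∸ M
    Ey≡ = begin-equality
      E y                                ≡⟨ sym (E-+-∸ x y (<⇒≤ x<y)) ⟩
      (E x + E (y ∸ x)) % M              ≡⟨ sym (m≤n⇒[n∸m]%m≡n%m M≤sum) ⟩
      (E x + E (y ∸ x) ∸ M) % M          ≡⟨ m<n⇒m%n≡m (+-cancelʳ-< M _ _ (subst (_< M + M) (sym (m∸n+n≡m M≤sum))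
                                              (+-mono-< (m%n<n (a * x) M) (m%n<n (a * (y ∸ x)) M)))) ⟩
      E x + E (y ∸ x) ∸ M                ∎

  window-weights-≤ : ∀ n N K → n < m → N ≤ n * n → (∀ i → i < K → 4 * odd i ≤ n) →
                     ∑[ i < K ] when (inWindow s (E (odd i))) (N / odd i) ≤ 128 * ∑ cost n
  window-weights-≤ n N K n<m N≤n² small = begin
    ∑[ i < K ] when (inWindow s (E (odd i))) (w i)  ≡⟨ ∑-cong K (λ i i<K →
                                                          cong (λ b → when (b ∧ inWindow s (E (odd i))) (w i))
                                                               (sym (Equivalence.to T-≡ (<⇒<ᵇ i<K)))) ⟩
    ∑[ i < K ] when (P i) (w i)                     ≤⟨ telescoping-≤ K P odd w (16 * C) 8 (λ _ → s≤s z≤n)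
                                                          (λ i j i≤j → s≤s (*-monoʳ-≤ 2 i≤j)) w≤16C gap spread ⟩
    8 * (16 * C)                                    ≡⟨ sym (*-assoc 8 16 C) ⟩
    128 * C                                         ∎
    where
    open ≤-Reasoning
    C = ∑ cost n
    w : ℕ → ℕ
    w i = N / odd i
    P : ℕ → Bool
    P i = (i <ᵇ K) ∧ inWindow s (E (odd i))
    selected : ∀ i → T (P i) → i < K × s < 16 * E (odd i) × 2 * E (odd i) ≤ s
    selected i Pi with Equivalence.to T-∧ Pi
    ... | i<K , window with Equivalence.to T-∧ window
    ...   | wide , short = <ᵇ⇒< i K i<K , <ᵇ⇒< s _ wide , ≤ᵇ⇒≤ (2 * E (odd i)) s short
    odd<m : ∀ i → T (P i) → odd i < m
    odd<m i Pi = ≤-<-trans (≤-trans (m≤n*m (odd i) 4) (small i (proj₁ (selected i Pi)))) n<m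
    w≤16C : ∀ i → T (P i) → w i ≤ 16 * C
    w≤16C i Pi = *-cancelʳ-≤ (w i) (16 * C) (odd i) (begin
      w i * odd i           ≤⟨ m/n*n≤m N (odd i) ⟩
      N                     ≤⟨ N≤n² ⟩
      n * n                 ≤⟨ ∑cost-≥ n (odd i) n<m (s≤s z≤n) (small i (proj₁ (selected i Pi)))
                                 (proj₂ (proj₂ (selected i Pi))) ⟩
      16 * odd i * C        ≡⟨ regroup (odd i) C ⟩
      16 * C * odd i        ∎)
      where
      regroup : ∀ y c → 16 * y * c ≡ 16 * c * y
      regroup = solve-∀
    -- Two selected multipliers y < y′ give a short step E (y′ - y), hence a cost bound
    -- with q = y′ - y.
    gap : ∀ i j → i < j → T (P i) → T (P j) → odd j * w j + 16 * C * odd i ≤ 16 * C * odd j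
    gap i j i<j Pi Pj = begin
      odd j * w j + 16 * C * odd i      ≤⟨ +-monoˡ-≤ (16 * C * odd i) (subst (_≤ N) (*-comm (w j) (odd j)) (m/n*n≤m N (odd j))) ⟩
      N + 16 * C * odd i                ≤⟨ +-monoˡ-≤ (16 * C * odd i) (≤-trans N≤n² n²≤16qC) ⟩
      16 * q * C + 16 * C * odd i       ≡⟨ regroup q C (odd i) ⟩
      16 * C * (q + odd i)              ≡⟨ cong (16 * C *_) (m∸n+n≡m (<⇒≤ oi<oj)) ⟩
      16 * C * odd j                    ∎
      where
      oi<oj : odd i < odd j
      oi<oj = s≤s (*-monoʳ-< 2 i<j)
      q = odd j ∸ odd i
      n²≤16qC : n * n ≤ 16 * q * C
      n²≤16qC = ∑cost-≥ n q n<m (m<n⇒0<n∸m oi<oj)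
        (≤-trans (*-monoʳ-≤ 4 (m∸n≤m (odd j) (odd i))) (small j (proj₁ (selected j Pj))))
        (short-difference (odd i) (odd j) oi<oj (odd<m j Pj)
           (proj₂ (proj₂ (selected i Pi))) (proj₂ (proj₂ (selected j Pj))))
      regroup : ∀ q c y → 16 * q * c + 16 * c * y ≡ 16 * c * (q + y)
      regroup = solve-∀
    spread : ∀ i j → T (P i) → T (P j) → odd j ≤ 8 * odd i
    spread i j Pi Pj = window-ratio (odd i) (odd j) (s≤s z≤n) (odd<m i Pi) (odd<m j Pj)
      (proj₁ (proj₂ (selected i Pi))) (proj₂ (proj₂ (selected i Pi))) (proj₂ (proj₂ (selected j Pj)))

even-or-odd : ∀ c → Σ ℕ (λ c′ → c ≡ 2 * c′ ⊎ c ≡ suc (2 * c′))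
even-or-odd zero    = 0 , inj₁ refl
even-or-odd (suc c) with even-or-odd c
... | c′ , inj₁ even = c′ , inj₂ (cong suc even)
... | c′ , inj₂ odd′ = suc c′ , inj₁ (trans (cong suc odd′) (twice-suc c′))
  where
  twice-suc : ∀ x → suc (suc (2 * x)) ≡ 2 * suc x
  twice-suc = solve-∀

-- Hensel lifting: an inverse modulo 2^(L+1) is corrected by 2^L when it is off by an odd multiple.
odd-inverse : ∀ i L → Σ ℕ (λ z → Σ ℕ (λ c → odd i * odd z ≡ 1 + 2 ^ suc L * c))
odd-inverse i zero = 0 , i , base i
  where
  base : ∀ i → suc (2 * i) * suc (2 * 0) ≡ 1 + 2 ^ 1 * i
  base = solve-∀
odd-inverse i (suc L) with odd-inverse i L
... | z , c , inverse with even-or-odd c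
...   | c′ , inj₁ refl = z , c′ , trans inverse (cong suc (regroup (2 ^ L) c′))
  where
  regroup : ∀ P c′ → 2 * P * (2 * c′) ≡ 2 * (2 * P) * c′
  regroup = solve-∀
...   | c′ , inj₂ refl = z + 2 ^ L , c′ + i + 1 , (begin
      odd i * odd (z + 2 ^ L)                                     ≡⟨ expand i z (2 ^ L) ⟩
      odd i * odd z + odd i * (2 * 2 ^ L)                         ≡⟨ cong (_+ odd i * (2 * 2 ^ L)) inverse ⟩
      1 + 2 * 2 ^ L * suc (2 * c′) + odd i * (2 * 2 ^ L)          ≡⟨ collect i c′ (2 ^ L) ⟩
      1 + 2 * (2 * 2 ^ L) * (c′ + i + 1)                          ∎)
  where
  open ≡-Reasoning
  expand : ∀ i z P → suc (2 * i) * suc (2 * (z + P)) ≡ suc (2 * i) * suc (2 * z) + suc (2 * i) * (2 * P)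
  expand = solve-∀
  collect : ∀ i c P → 1 + 2 * P * suc (2 * c) + suc (2 * i) * (2 * P) ≡ 1 + 2 * (2 * P) * (c + i + 1)
  collect = solve-∀

odd-%-double : ∀ p K .{{_ : NonZero K}} .{{_ : NonZero (2 * K)}} → odd p % (2 * K) ≡ odd (p % K)
odd-%-double p K = begin
  odd p % (2 * K)                                ≡⟨ cong (λ z → odd z % (2 * K)) (m≡m%n+[m/n]*n p K) ⟩
  odd (p % K + p / K * K) % (2 * K)              ≡⟨ cong (_% (2 * K)) (regroup (p % K) (p / K) K) ⟩
  (odd (p % K) + p / K * (2 * K)) % (2 * K)      ≡⟨ [m+kn]%n≡m%n (odd (p % K)) (p / K) (2 * K) ⟩
  odd (p % K) % (2 * K)                          ≡⟨ m<n⇒m%n≡m (≤-trans (≤-reflexive (sym (twice-suc (p % K))))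
                                                                        (*-monoʳ-≤ 2 (m%n<n p K))) ⟩
  odd (p % K)                                    ∎
  where
  open ≡-Reasoning
  regroup : ∀ r q K → suc (2 * (r + q * K)) ≡ suc (2 * r) + q * (2 * K)
  regroup = solve-∀
  twice-suc : ∀ K → 2 * suc K ≡ suc (suc (2 * K))
  twice-suc = solve-∀

module OddResidues (L : ℕ) where

  instance
    2^L≢0 : NonZero (2 ^ L)
    2^L≢0 = m^n≢0 2 L
    2^[1+L]≢0 : NonZero (2 ^ suc L)
    2^[1+L]≢0 = m^n≢0 2 (suc L)

  -- odd e · odd z = odd (2 e z + e + z), where odd z is the inverse of odd i.
  multiplier-for : ℕ → ℕ → ℕ
  multiplier-for i e = (2 * e * z + e + z) % 2 ^ L
    where z = proj₁ (odd-inverse i L)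

  multiplier-for-< : ∀ i e → multiplier-for i e < 2 ^ L
  multiplier-for-< i e = m%n<n _ (2 ^ L)

  multiplier-for-hits : ∀ i e → odd e < 2 ^ suc L → (odd (multiplier-for i e) * odd i) % 2 ^ suc L ≡ odd e
  multiplier-for-hits i e e<M = begin
    (odd (p % 2 ^ L) * odd i) % M               ≡⟨ cong (λ w → (w * odd i) % M) (sym (odd-%-double p (2 ^ L))) ⟩
    (odd p % M * odd i) % M                     ≡⟨ %-*-absorbˡ (odd p) (odd i) M ⟩
    (odd p * odd i) % M                         ≡⟨ cong (λ w → (w * odd i) % M) (sym (odd-* e z)) ⟩
    (odd e * odd z * odd i) % M                 ≡⟨ cong (_% M) (regroup (odd e) (odd z) (odd i)) ⟩
    (odd e * (odd i * odd z)) % M               ≡⟨ cong (λ w → (odd e * w) % M) inverse ⟩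
    (odd e * (1 + M * c)) % M                   ≡⟨ cong (_% M) (distribute (odd e) M c) ⟩
    (odd e + odd e * c * M) % M                 ≡⟨ [m+kn]%n≡m%n (odd e) (odd e * c) M ⟩
    odd e % M                                   ≡⟨ m<n⇒m%n≡m e<M ⟩
    odd e                                       ∎
    where
    open ≡-Reasoning
    M = 2 ^ suc L
    z = proj₁ (odd-inverse i L)
    c = proj₁ (proj₂ (odd-inverse i L))
    inverse : odd i * odd z ≡ 1 + M * c
    inverse = proj₂ (proj₂ (odd-inverse i L))
    p = 2 * e * z + e + z
    odd-* : ∀ e z → suc (2 * e) * suc (2 * z) ≡ suc (2 * (2 * e * z + e + z))
    odd-* = solve-∀
    regroup : ∀ e z i → e * z * i ≡ e * (i * z)
    regroup = solve-∀
    distribute : ∀ e M c → e * (1 + M * c) ≡ e + e * c * M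
    distribute = solve-∀

  -- The odd numbers odd (u + k), k ≤ u = ⌊s/16⌋, lie in the window (s/16, s/2].
  window-count : ∀ s i → 2 ≤ s → s ≤ 2 ^ suc L →
    s / 16 + 1 ≤ count (λ j → inWindow s ((odd j * odd i) % 2 ^ suc L)) (2 ^ L)
  window-count s i 2≤s s≤M =
    injective-≤-count (u + 1) (2 ^ L) f (λ j → inWindow s ((odd j * odd i) % 2 ^ suc L)) f-injective
      (λ k _ → multiplier-for-< i (u + k))
      (λ k k≤u → subst (λ x → T (inWindow s x)) (sym (hits k k≤u))
                   (Equivalence.from T-∧ (<⇒<ᵇ (wide k) , ≤⇒≤ᵇ (short k k≤u))))
    where
    u = s / 16
    8u+2≤s : 8 * u + 2 ≤ s
    8u+2≤s with u in u≡
    ... | zero   = 2≤s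
    ... | suc u′ = begin
      8 * suc u′ + 2             ≤⟨ +-monoʳ-≤ (8 * suc u′) (≤-trans (s≤s (s≤s (z≤n {6}))) (*-monoʳ-≤ 8 (s≤s (z≤n {u′})))) ⟩
      8 * suc u′ + 8 * suc u′    ≡⟨ double (suc u′) ⟩
      suc u′ * 16                ≤⟨ subst (λ x → x * 16 ≤ s) u≡ (m/n*n≤m s 16) ⟩
      s                          ∎
      where
      open ≤-Reasoning
      double : ∀ x → 8 * x + 8 * x ≡ x * 16
      double = solve-∀
    short : ∀ k → k < u + 1 → 2 * odd (u + k) ≤ s
    short k k≤u = ≤-trans (*-monoʳ-≤ 2 (s≤s (*-monoʳ-≤ 2 (+-monoʳ-≤ u (s≤s⁻¹ (subst (k <_) (+-comm u 1) k≤u))))))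
                          (≤-trans (≤-reflexive (regroup u)) 8u+2≤s)
      where
      regroup : ∀ u → 2 * suc (2 * (u + u)) ≡ 8 * u + 2
      regroup = solve-∀
    wide : ∀ k → s < 16 * odd (u + k)
    wide k = begin-strict
      s                        ≡⟨ m≡m%n+[m/n]*n s 16 ⟩
      s % 16 + u * 16          <⟨ +-monoˡ-< (u * 16) (m%n<n s 16) ⟩
      16 + u * 16              ≡⟨ regroup u ⟩
      16 * suc u               ≤⟨ *-monoʳ-≤ 16 (s≤s (≤-trans (m≤m+n u k) (m≤n*m (u + k) 2))) ⟩
      16 * odd (u + k)         ∎
      where
      open ≤-Reasoning
      regroup : ∀ u → 16 + u * 16 ≡ 16 * suc u
      regroup = solve-∀
    f : ℕ → ℕ
    f k = multiplier-for i (u + k)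
    hits : ∀ k → k < u + 1 → (odd (f k) * odd i) % 2 ^ suc L ≡ odd (u + k)
    hits k k≤u = multiplier-for-hits i (u + k) (<-≤-trans (m<m+n (odd (u + k)) z<s) (≤-trans (short k k≤u) s≤M))
    f-injective : InjectiveBelow (u + 1) f
    f-injective k k′ k≤u k′≤u same = +-cancelˡ-≡ u k k′ (*-cancelˡ-≡ (u + k) (u + k′) 2 (suc-injective (begin
      odd (u + k)                        ≡⟨ sym (hits k k≤u) ⟩
      (odd (f k) * odd i) % 2 ^ suc L    ≡⟨ cong (λ j → (odd j * odd i) % 2 ^ suc L) same ⟩
      (odd (f k′) * odd i) % 2 ^ suc L   ≡⟨ hits k′ k′≤u ⟩
      odd (u + k′)                       ∎)))
      where open ≡-Reasoning

-- Each of the 2^t terms with 2^t ≤ i < 2^(t+1) has odd i ≤ 2^(t+2), hence is at least 2^(e-t-2).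
odd-harmonic-≥ : ∀ e t → t + 2 ≤ e → t * 2 ^ (e ∸ 2) ≤ ∑[ i < 2 ^ t ] (2 ^ e / odd i)
odd-harmonic-≥ e zero    t+2≤e = z≤n
odd-harmonic-≥ e (suc t) t+3≤e = begin
  suc t * 2 ^ (e ∸ 2)                              ≡⟨ +-comm (2 ^ (e ∸ 2)) (t * 2 ^ (e ∸ 2)) ⟩
  t * 2 ^ (e ∸ 2) + 2 ^ (e ∸ 2)                    ≤⟨ +-mono-≤ (odd-harmonic-≥ e t t+2≤e) upperHalf ⟩
  ∑ f (2 ^ t) + ∑[ i < 2 ^ t ] f (2 ^ t + i)       ≡⟨ sym (∑-split (2 ^ t) (2 ^ t) f) ⟩
  ∑ f (2 ^ t + 2 ^ t)                              ≡⟨ cong (λ k → ∑ f (2 ^ t + k)) (sym (+-identityʳ (2 ^ t))) ⟩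
  ∑ f (2 ^ suc t)                                  ∎
  where
  open ≤-Reasoning
  instance
    2^[t+2]≢0 : NonZero (2 ^ (t + 2))
    2^[t+2]≢0 = m^n≢0 2 (t + 2)
  f : ℕ → ℕ
  f i = 2 ^ e / odd i
  t+2≤e : t + 2 ≤ e
  t+2≤e = ≤-trans (n≤1+n _) t+3≤e
  d = e ∸ (t + 2)
  e≡ : e ≡ (t + 2) + d
  e≡ = sym (m+[n∸m]≡n t+2≤e)
  term : 2 ^ e / 2 ^ (t + 2) ≡ 2 ^ d
  term = begin-equality
    2 ^ e / 2 ^ (t + 2)                    ≡⟨ cong (λ z → 2 ^ z / 2 ^ (t + 2)) e≡ ⟩
    2 ^ ((t + 2) + d) / 2 ^ (t + 2)        ≡⟨ cong (_/ 2 ^ (t + 2)) (trans (^-distribˡ-+-* 2 (t + 2) d) (*-comm (2 ^ (t + 2)) (2 ^ d))) ⟩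
    (2 ^ d * 2 ^ (t + 2)) / 2 ^ (t + 2)    ≡⟨ m*n/n≡m (2 ^ d) (2 ^ (t + 2)) ⟩
    2 ^ d                                  ∎
  even-or-odd-total : 2 ^ t * 2 ^ d ≡ 2 ^ (e ∸ 2)
  even-or-odd-total = begin-equality
    2 ^ t * 2 ^ d       ≡⟨ sym (^-distribˡ-+-* 2 t d) ⟩
    2 ^ (t + d)         ≡⟨ cong (2 ^_) (sym (trans (cong (_∸ 2) e≡) (cancel t d))) ⟩
    2 ^ (e ∸ 2)         ∎
    where
    cancel : ∀ t d → (t + 2) + d ∸ 2 ≡ t + d
    cancel t d = trans (cong (_∸ 2) (+-comm-2 t d)) (m+n∸n≡m (t + d) 2)
      where
      +-comm-2 : ∀ t d → (t + 2) + d ≡ (t + d) + 2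
      +-comm-2 = solve-∀
  term-≥ : ∀ i → i < 2 ^ t → 2 ^ d ≤ f (2 ^ t + i)
  term-≥ i i<2^t = subst (_≤ f (2 ^ t + i)) term (/-monoʳ-≤ (2 ^ e) odd≤)
    where
    odd≤ : odd (2 ^ t + i) ≤ 2 ^ (t + 2)
    odd≤ = begin
      suc (2 * (2 ^ t + i))           ≤⟨ n≤1+n _ ⟩
      suc (suc (2 * (2 ^ t + i)))     ≡⟨ twice-suc (2 ^ t + i) ⟩
      2 * suc (2 ^ t + i)             ≡⟨ cong (2 *_) (sym (+-suc (2 ^ t) i)) ⟩
      2 * (2 ^ t + suc i)             ≤⟨ *-monoʳ-≤ 2 (+-monoʳ-≤ (2 ^ t) i<2^t) ⟩
      2 * (2 ^ t + 2 ^ t)             ≡⟨ quadruple (2 ^ t) ⟩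
      2 ^ t * 4                       ≡⟨ sym (^-distribˡ-+-* 2 t 2) ⟩
      2 ^ (t + 2)                     ∎
      where
      twice-suc : ∀ x → suc (suc (2 * x)) ≡ 2 * suc x
      twice-suc = solve-∀
      quadruple : ∀ x → 2 * (x + x) ≡ x * 4
      quadruple = solve-∀
  upperHalf : 2 ^ (e ∸ 2) ≤ ∑[ i < 2 ^ t ] f (2 ^ t + i)
  upperHalf = begin
    2 ^ (e ∸ 2)                    ≡⟨ sym even-or-odd-total ⟩
    2 ^ t * 2 ^ d                  ≡⟨ sym (∑-const (2 ^ t) (2 ^ d)) ⟩
    ∑[ _ < 2 ^ t ] (2 ^ d)         ≤⟨ ∑-mono-≤ (2 ^ t) term-≥ ⟩
    ∑[ i < 2 ^ t ] f (2 ^ t + i)   ∎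

2^⌊log₂⌋≤ : ∀ n → 1 ≤ n → 2 ^ ⌊log₂ n ⌋ ≤ n
2^⌊log₂⌋≤ = <-rec (λ n → 1 ≤ n → 2 ^ ⌊log₂ n ⌋ ≤ n) step
  where
  step : ∀ n → (∀ {k} → k < n → 1 ≤ k → 2 ^ ⌊log₂ k ⌋ ≤ k) → 1 ≤ n → 2 ^ ⌊log₂ n ⌋ ≤ n
  step (suc zero)    _  _ = ≤-reflexive (cong (2 ^_) (⌊log₂[2^n]⌋≡n 0))
  step (suc (suc n)) ih _ = begin
    2 ^ ⌊log₂ N ⌋                  ≡⟨ cong (2 ^_) (sym (m∸n+n≡m 1≤log)) ⟩
    2 ^ (⌊log₂ N ⌋ ∸ 1 + 1)        ≡⟨ cong (2 ^_) (+-comm (⌊log₂ N ⌋ ∸ 1) 1) ⟩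
    2 * 2 ^ (⌊log₂ N ⌋ ∸ 1)        ≡⟨ cong (λ z → 2 * 2 ^ z) (sym (⌊log₂⌊n/2⌋⌋≡⌊log₂n⌋∸1 N)) ⟩
    2 * 2 ^ ⌊log₂ ⌊ N /2⌋ ⌋        ≤⟨ *-monoʳ-≤ 2 (ih {⌊ N /2⌋} (⌊n/2⌋<n (suc n)) (s≤s z≤n)) ⟩
    2 * ⌊ N /2⌋                    ≡⟨ cong (⌊ N /2⌋ +_) (+-identityʳ ⌊ N /2⌋) ⟩
    ⌊ N /2⌋ + ⌊ N /2⌋              ≤⟨ +-monoʳ-≤ ⌊ N /2⌋ (⌊n/2⌋≤⌈n/2⌉ N) ⟩
    ⌊ N /2⌋ + ⌈ N /2⌉              ≡⟨ ⌊n/2⌋+⌈n/2⌉≡n N ⟩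
    N                              ∎
    where
    open ≤-Reasoning
    N = suc (suc n)
    1≤log : 1 ≤ ⌊log₂ N ⌋
    1≤log = subst (_≤ ⌊log₂ N ⌋) (⌊log₂[2^n]⌋≡n 1) (⌊log₂⌋-mono-≤ {2} {N} (s≤s (s≤s z≤n)))

<2^suc⌊log₂⌋ : ∀ n → n < 2 ^ suc ⌊log₂ n ⌋
<2^suc⌊log₂⌋ n with n <? 2 ^ suc ⌊log₂ n ⌋
... | yes n<2^[1+k] = n<2^[1+k]
... | no  n≮2^[1+k] = ⊥-elim (<-irrefl refl (subst (_≤ ⌊log₂ n ⌋) (⌊log₂[2^n]⌋≡n (suc ⌊log₂ n ⌋))
                                                (⌊log₂⌋-mono-≤ (≮⇒≥ n≮2^[1+k]))))

sum-map-applyUpTo : ∀ (g f : ℕ → ℕ) n → sum (map g (applyUpTo f n)) ≡ ∑[ i < n ] g (f i)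
sum-map-applyUpTo g f zero    = refl
sum-map-applyUpTo g f (suc n) = cong (g (f 0) +_) (sum-map-applyUpTo g (λ i → f (suc i)) n)

sumCostOdd≡∑ : ∀ ℓ ℓout n → sumCostOdd ℓ ℓout n ≡ ∑[ j < 2 ^ (ℓ ∸ 1) ] totalCost ℓ ℓout n (odd j)
sumCostOdd≡∑ ℓ ℓout n = sum-map-applyUpTo (λ j → totalCost ℓ ℓout n (odd j)) (λ i → i) (2 ^ (ℓ ∸ 1))

totalCost≡∑cost : ∀ ℓ ℓout a (ℓout≤ℓ : ℓout ≤ ℓ) n →
                  totalCost ℓ ℓout n a ≡ ∑ (MultiplicativeHashing.cost ℓ ℓout a ℓout≤ℓ) n
totalCost≡∑cost ℓ ℓout a ℓout≤ℓ n = MultiplicativeHashing.insertAll≡∑cost ℓ ℓout a ℓout≤ℓ n 0 (λ i → i) (λ i → refl)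

totalCost-≥ : ∀ ℓ ℓout a → ℓout ≤ ℓ → ∀ n → n < 2 ^ ℓout → n ≤ totalCost ℓ ℓout n a
totalCost-≥ ℓ ℓout a ℓout≤ℓ n n<m = begin
  n                                ≡⟨ sym (∑-count n) ⟩
  ∑[ _ < n ] 1                     ≤⟨ ∑-mono-≤ n (λ k k<n → cost≥1 k (<-trans k<n n<m)) ⟩
  ∑ cost n                         ≡⟨ sym (totalCost≡∑cost ℓ ℓout a ℓout≤ℓ n) ⟩
  totalCost ℓ ℓout n a             ∎
  where
  open ≤-Reasoning
  open MultiplicativeHashing ℓ ℓout a ℓout≤ℓ using (cost; cost≥1)

sumCostOdd-≥-linear : ∀ ℓ ℓout n → ℓout ≤ ℓ → n < 2 ^ ℓout → n * 2 ^ (ℓ ∸ 1) ≤ sumCostOdd ℓ ℓout n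
sumCostOdd-≥-linear ℓ ℓout n ℓout≤ℓ n<m = begin
  n * A                                      ≡⟨ *-comm n A ⟩
  A * n                                      ≡⟨ sym (∑-const A n) ⟩
  ∑[ _ < A ] n                               ≤⟨ ∑-mono-≤ A (λ j _ → totalCost-≥ ℓ ℓout (odd j) ℓout≤ℓ n n<m) ⟩
  ∑[ j < A ] totalCost ℓ ℓout n (odd j)      ≡⟨ sym (sumCostOdd≡∑ ℓ ℓout n) ⟩
  sumCostOdd ℓ ℓout n                        ∎
  where
  open ≤-Reasoning
  A = 2 ^ (ℓ ∸ 1)

-- Summing the window bound over all odd multipliers: the weight 2^(2k)/y of each odd
-- y < 2^(k-2) is counted for at least s/16 + 1 multipliers, and these weights add up
-- to a harmonic sum of size about k 4^k.
sumCostOdd-≥-harmonic : ∀ L ℓout n → ℓout < suc L → n < 2 ^ ℓout → 6 ≤ ⌊log₂ n ⌋ →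
  (2 ^ (suc L ∸ ℓout) / 16 + 1) * ((⌊log₂ n ⌋ ∸ 3) * 2 ^ (⌊log₂ n ⌋ + ⌊log₂ n ⌋ ∸ 2))
    ≤ 128 * sumCostOdd (suc L) ℓout n
sumCostOdd-≥-harmonic L ℓout n ℓout<ℓ n<m k≥6 = begin
  t * ((k ∸ 3) * 2 ^ (k + k ∸ 2))          ≤⟨ *-monoʳ-≤ t (odd-harmonic-≥ (k + k) (k ∸ 3) (+-mono-≤ (m∸n≤m k 3) 2≤k)) ⟩
  t * ∑ w K                                ≡⟨ sym (∑-*ˡ K t w) ⟩
  ∑[ i < K ] (t * w i)                     ≤⟨ ∑-mono-≤ K (λ i _ → counted i) ⟩
  ∑[ i < K ] ∑[ j < A ] F j i              ≡⟨ sym (∑-swap A K F) ⟩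
  ∑[ j < A ] ∑[ i < K ] F j i              ≤⟨ ∑-mono-≤ A (λ j _ → per-multiplier j) ⟩
  ∑[ j < A ] (128 * totalCost ℓ ℓout n (odd j))  ≡⟨ ∑-*ˡ A 128 (λ j → totalCost ℓ ℓout n (odd j)) ⟩
  128 * ∑[ j < A ] totalCost ℓ ℓout n (odd j)    ≡⟨ cong (128 *_) (sym (sumCostOdd≡∑ ℓ ℓout n)) ⟩
  128 * sumCostOdd ℓ ℓout n                      ∎
  where
  open ≤-Reasoning
  open OddResidues L using (window-count; 2^[1+L]≢0)
  ℓ = suc L
  ℓout≤ℓ = <⇒≤ ℓout<ℓ
  k = ⌊log₂ n ⌋
  K = 2 ^ (k ∸ 3)
  A = 2 ^ L
  N = 2 ^ (k + k)
  s = 2 ^ (ℓ ∸ ℓout)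
  t = s / 16 + 1
  w : ℕ → ℕ
  w i = N / odd i
  F : ℕ → ℕ → ℕ
  F j i = when (inWindow s (MultiplicativeHashing.E ℓ ℓout (odd j) ℓout≤ℓ (odd i))) (w i)
  2≤k : 2 ≤ k
  2≤k = ≤-trans (s≤s (s≤s (z≤n {4}))) k≥6
  2^k≤n : 2 ^ k ≤ n
  2^k≤n = 2^⌊log₂⌋≤ n (positive n (≤-trans (s≤s z≤n) k≥6))
    where
    positive : ∀ n → 1 ≤ ⌊log₂ n ⌋ → 1 ≤ n
    positive zero    ()
    positive (suc n) _ = s≤s z≤n
  N≤n² : N ≤ n * n
  N≤n² = subst (_≤ n * n) (sym (^-distribˡ-+-* 2 k k)) (*-mono-≤ 2^k≤n 2^k≤n)
  small : ∀ i → i < K → 4 * odd i ≤ n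
  small i i<K = begin
    4 * odd i        ≤⟨ *-monoʳ-≤ 4 (≤-trans (n≤1+n _) (≤-trans (≤-reflexive (twice-suc i)) (*-monoʳ-≤ 2 i<K))) ⟩
    4 * (2 * K)      ≡⟨ eight K ⟩
    2 ^ (3 + (k ∸ 3)) ≡⟨ cong (2 ^_) (trans (+-comm 3 (k ∸ 3)) (m∸n+n≡m (≤-trans (s≤s (s≤s (s≤s (z≤n {3})))) k≥6))) ⟩
    2 ^ k            ≤⟨ 2^k≤n ⟩
    n                ∎
    where
    twice-suc : ∀ i → suc (suc (2 * i)) ≡ 2 * suc i
    twice-suc = solve-∀
    eight : ∀ x → 4 * (2 * x) ≡ 2 * (2 * (2 * x))
    eight = solve-∀
  per-multiplier : ∀ j → ∑[ i < K ] F j i ≤ 128 * totalCost ℓ ℓout n (odd j)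
  per-multiplier j = subst (λ c → ∑[ i < K ] F j i ≤ 128 * c) (sym (totalCost≡∑cost ℓ ℓout (odd j) ℓout≤ℓ n))
                 (MultiplicativeHashing.window-weights-≤ ℓ ℓout (odd j) ℓout≤ℓ n N K n<m N≤n² small)
  counted : ∀ i → t * w i ≤ ∑[ j < A ] F j i
  counted i = begin
    t * w i                                     ≡⟨ *-comm t (w i) ⟩
    w i * t                                     ≤⟨ *-monoʳ-≤ (w i) (window-count s i 2≤s s≤2^ℓ) ⟩
    w i * count (λ j → inWindow s ((odd j * odd i) % 2 ^ ℓ)) A  ≡⟨ sym (∑-*ˡ A (w i) _) ⟩
    ∑[ j < A ] (w i * when (inWindow s ((odd j * odd i) % 2 ^ ℓ)) 1)
                                                ≡⟨ ∑-cong A (λ j _ → sym (when-*-count _ (w i))) ⟩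
    ∑[ j < A ] F j i                            ∎
    where
    2≤s : 2 ≤ s
    2≤s = ^-monoʳ-≤ 2 {1} (m<n⇒0<n∸m ℓout<ℓ)
    s≤2^ℓ : s ≤ 2 ^ ℓ
    s≤2^ℓ = ^-monoʳ-≤ 2 (m∸n≤m ℓ ℓout)

sumCostOdd-≥-nlogn : ∀ C L ℓout n → ℓout < suc L → n < 2 ^ ℓout → 2 ^ ℓout ≤ C * n → 6 ≤ ⌊log₂ n ⌋ →
                     n * 2 ^ L * ⌊log₂ n ⌋ ≤ 32768 * C * sumCostOdd (suc L) ℓout n
sumCostOdd-≥-nlogn C L ℓout n ℓout<ℓ n<m m≤Cn k≥6 = *-cancelˡ-≤ 2 (begin
  2 * (n * A * k)                                  ≡⟨ r₁ n A k ⟩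
  n * (2 * A) * k                                  ≡⟨ cong (λ z → n * z * k) (MultiplicativeHashing.M≡m*s (suc L) ℓout 1 (<⇒≤ ℓout<ℓ)) ⟩
  n * (2 ^ ℓout * s) * k                           ≤⟨ *-monoˡ-≤ k (*-monoʳ-≤ n (*-monoˡ-≤ s m≤Cn)) ⟩
  n * (C * n * s) * k                              ≡⟨ r₂ n C s k ⟩
  n * n * (C * s * k)                              ≤⟨ *-monoˡ-≤ (C * s * k) (*-mono-≤ n≤2P n≤2P) ⟩
  2 * P * (2 * P) * (C * s * k)                    ≡⟨ r₃ P C s k ⟩
  4 * (P * P) * (C * s * k)                        ≡⟨ cong (λ z → 4 * z * (C * s * k)) P²≡4Z ⟩
  4 * (4 * Z) * (C * s * k)                        ≤⟨ *-monoʳ-≤ (4 * (4 * Z)) (*-mono-≤ (*-monoʳ-≤ C s≤16t) k≤2[k∸3]) ⟩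
  4 * (4 * Z) * (C * (16 * t) * (2 * (k ∸ 3)))     ≡⟨ r₄ Z C t (k ∸ 3) ⟩
  512 * C * (t * ((k ∸ 3) * Z))                    ≤⟨ *-monoʳ-≤ (512 * C) (sumCostOdd-≥-harmonic L ℓout n ℓout<ℓ n<m k≥6) ⟩
  512 * C * (128 * sumCostOdd (suc L) ℓout n)      ≡⟨ r₅ C (sumCostOdd (suc L) ℓout n) ⟩
  2 * (32768 * C * sumCostOdd (suc L) ℓout n)      ∎)
  where
  open ≤-Reasoning
  k = ⌊log₂ n ⌋
  A = 2 ^ L
  P = 2 ^ k
  Z = 2 ^ (k + k ∸ 2)
  s = 2 ^ (suc L ∸ ℓout)
  t = s / 16 + 1
  n≤2P : n ≤ 2 * P
  n≤2P = <⇒≤ (<2^suc⌊log₂⌋ n)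
  P²≡4Z : P * P ≡ 4 * Z
  P²≡4Z = begin-equality
    P * P                  ≡⟨ sym (^-distribˡ-+-* 2 k k) ⟩
    2 ^ (k + k)            ≡⟨ cong (2 ^_) (sym (m+[n∸m]≡n {2} (+-mono-≤ (≤-trans (s≤s z≤n) k≥6) (≤-trans (s≤s z≤n) k≥6)))) ⟩
    2 ^ (2 + (k + k ∸ 2))  ≡⟨ ^-distribˡ-+-* 2 2 (k + k ∸ 2) ⟩
    4 * Z                  ∎
  s≤16t : s ≤ 16 * t
  s≤16t = <⇒≤ (begin-strict
    s                      ≡⟨ m≡m%n+[m/n]*n s 16 ⟩
    s % 16 + s / 16 * 16   <⟨ +-monoˡ-< (s / 16 * 16) (m%n<n s 16) ⟩
    16 + s / 16 * 16       ≡⟨ collect (s / 16) ⟩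
    16 * t                 ∎)
    where
    collect : ∀ u → 16 + u * 16 ≡ 16 * (u + 1)
    collect = solve-∀
  k≤2[k∸3] : k ≤ 2 * (k ∸ 3)
  k≤2[k∸3] = begin
    k                      ≡⟨ sym (m∸n+n≡m (≤-trans (s≤s (s≤s (s≤s (z≤n {3})))) k≥6)) ⟩
    (k ∸ 3) + 3            ≤⟨ +-monoʳ-≤ (k ∸ 3) (∸-monoˡ-≤ 3 k≥6) ⟩
    (k ∸ 3) + (k ∸ 3)      ≡⟨ cong ((k ∸ 3) +_) (sym (+-identityʳ (k ∸ 3))) ⟩
    2 * (k ∸ 3)            ∎
  r₁ : ∀ n A k → 2 * (n * A * k) ≡ n * (2 * A) * k
  r₁ = solve-∀
  r₂ : ∀ n C s k → n * (C * n * s) * k ≡ n * n * (C * s * k)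
  r₂ = solve-∀
  r₃ : ∀ P C s k → 2 * P * (2 * P) * (C * s * k) ≡ 4 * (P * P) * (C * s * k)
  r₃ = solve-∀
  r₄ : ∀ Z C t T → 4 * (4 * Z) * (C * (16 * t) * (2 * T)) ≡ 512 * C * (t * (T * Z))
  r₄ = solve-∀
  r₅ : ∀ C S → 512 * C * (128 * S) ≡ 2 * (32768 * C * S)
  r₅ = solve-∀

theorem1 : (C : ℕ) → Σ ℕ (λ d → 1 ≤ d × ((ℓin ℓout ℓ n : ℕ) → 1 ≤ ℓin → 1 ≤ ℓout → 1 ≤ ℓ → ℓin ≤ ℓ → ℓout ≤ ℓ → ℓout < ℓ → n ≤ 2 ^ ℓin → n < 2 ^ ℓout → 2 ^ ℓout ≤ C * n → n * 2 ^ (ℓ ∸ 1) * ⌊log₂ n ⌋ ≤ d * sumCostOdd ℓ ℓout n))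
theorem1 C = d , ≤-trans (s≤s z≤n) (m≤n+m 6 (32768 * C)) , bound
  where
  d = 32768 * C + 6
  bound : (ℓin ℓout ℓ n : ℕ) → 1 ≤ ℓin → 1 ≤ ℓout → 1 ≤ ℓ → ℓin ≤ ℓ → ℓout ≤ ℓ → ℓout < ℓ → n ≤ 2 ^ ℓin →
          n < 2 ^ ℓout → 2 ^ ℓout ≤ C * n → n * 2 ^ (ℓ ∸ 1) * ⌊log₂ n ⌋ ≤ d * sumCostOdd ℓ ℓout n
  bound _ ℓout (suc L) n _ _ _ _ ℓout≤ℓ ℓout<ℓ _ n<m m≤Cn with 6 ≤? ⌊log₂ n ⌋
  ... | yes k≥6 = ≤-trans (sumCostOdd-≥-nlogn C L ℓout n ℓout<ℓ n<m m≤Cn k≥6) (*-monoˡ-≤ _ (m≤m+n (32768 * C) 6))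
  ... | no  k≱6 = begin
    n * 2 ^ L * ⌊log₂ n ⌋          ≤⟨ *-monoʳ-≤ (n * 2 ^ L) (<⇒≤ (≰⇒> k≱6)) ⟩
    n * 2 ^ L * 6                  ≡⟨ *-comm (n * 2 ^ L) 6 ⟩
    6 * (n * 2 ^ L)                ≤⟨ *-monoʳ-≤ 6 (sumCostOdd-≥-linear (suc L) ℓout n ℓout≤ℓ n<m) ⟩
    6 * sumCostOdd (suc L) ℓout n  ≤⟨ *-monoˡ-≤ _ (m≤n+m 6 (32768 * C)) ⟩
    d * sumCostOdd (suc L) ℓout n  ∎
    where open ≤-Reasoning
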